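{- Let $P$ be a connected finite $\Gamma$-colored minuscule poset. Then either $P$ is a chain and $\Gamma$ is simply laced, or $P$ is slant irreducible as a $\Gamma$-colored $d$-complete poset.
   Context: Dynkin diagram $\Gamma$: finite set with integers $\theta_{ab}$, $\theta_{aa}=2$, $\theta_{ab}\le0$ ($a\ne b$), $\theta_{ab}=0\iff\theta_{ba}=0$; $a\sim b$ if $a\ne b$ and $\theta_{ab}<0$; simply laced: all $\theta_{ab}\in\{ -1,0,2\}$. $\Gamma$-colored poset: poset with surjective $\kappa:P\to\Gamma$. Consecutive elements of color $a$: $x<y$ of color $a$, no color-$a$ element in $(x,y)$. $U(x,P)=\{y>x:\kappa(y)\sim\kappa(x)\}$, $L(x,P)=\{y<x:\kappa(y)\sim\kappa(x)\}$. $\Gamma$-colored $d$-complete: locally finite with (EC) equal colors comparable; (NA) neighbors (one covers the other) have adjacent colors; (AC) adjacent colors comparable; (ICE2) consecutive $x<y$ of color $a$ have $\sum_{z\in(x,y)}-\theta_{\kappa(z),a}=2$; (UCB1) for maximal $x$ of color $a$, $U(x,P)$ finite and $\sum_{y\in U(x,P)}-\theta_{\kappa(y),a}\le1$. $\Gamma$-colored minuscule: additionally (LCB1) for minimal $x$ of color $a$, $L(x,P)$ finite and $\sum_{y\in L(x,P)}-\theta_{\kappa(y),a}\le1$. Top tree $T$ of finite $P$: elements maximal among elements of their color. $P$ is slant irreducible if connected and whenever $x,y\in T$ with $y$ covering $x$, $y$ is not the only element of its color in $P$. -}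

module Defs where

open import Data.Nat using (ℕ)
open import Data.Fin using (Fin)
open import Data.Fin.Properties using (_≟_)
open import Data.Integer as ℤ using (ℤ; +_; -_; -1ℤ; 0ℤ; 1ℤ)
open import Data.List using (List; map; filter; foldr)
open import Data.Product using (Σ; ∃; ∃-syntax; _×_; _,_)
open import Data.Sum using (_⊎_)
open import Relation.Nullary using (¬_; Dec; yes; no)
open import Relation.Unary using (Pred; Decidable)
open import Relation.Binary using (Rel)
open import Relation.Binary.Structures using (IsDecPartialOrder)
open import Relation.Binary.PropositionalEquality using (_≡_; _≢_)
open import Relation.Binary.Construct.Closure.ReflexiveTransitive using (Star)
open import Data.List using (allFin)
open import Level using (0ℓ)

record Dynkin : Set where
  field
    k        : ℕ
    θ        : Fin k → Fin k → ℤ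
    θ-diag   : ∀ a → θ a a ≡ + 2
    θ-offdiag : ∀ a b → a ≢ b → θ a b ℤ.≤ 0ℤ
    θ-zero   : ∀ a b → (θ a b ≡ 0ℤ → θ b a ≡ 0ℤ) × (θ b a ≡ 0ℤ → θ a b ≡ 0ℤ)

module _ (Γ : Dynkin) where
  open Dynkin Γ

  Adjacent : Fin k → Fin k → Set
  Adjacent a b = a ≢ b × θ a b ℤ.< 0ℤ

  SimplyLaced : Set
  SimplyLaced = ∀ a b → (θ a b ≡ -1ℤ) ⊎ ((θ a b ≡ 0ℤ) ⊎ (θ a b ≡ + 2))

∑[_∣_] : ∀ {n} {P : Pred (Fin n) 0ℓ} → Decidable P → (Fin n → ℤ) → ℤ
∑[_∣_] {n} P? f = foldr ℤ._+_ 0ℤ (map f (filter P? (allFin n)))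

record ColoredPoset (Γ : Dynkin) : Set₁ where
  open Dynkin Γ
  field
    n          : ℕ
    _≼_        : Rel (Fin n) 0ℓ
    isDecPO    : IsDecPartialOrder _≡_ _≼_
    κ          : Fin n → Fin k
    κ-surj     : ∀ a → ∃[ x ] κ x ≡ a

  open IsDecPartialOrder isDecPO public using () renaming (_≤?_ to _≼?_)

  _≺_ : Rel (Fin n) 0ℓ
  x ≺ y = x ≼ y × x ≢ y

  Comparable : Rel (Fin n) 0ℓ
  Comparable x y = (x ≼ y) ⊎ (y ≼ x)

  _⋖_ : Rel (Fin n) 0ℓ
  x ⋖ y = x ≺ y × (∀ z → ¬ (x ≺ z × z ≺ y))

  Connected : Set
  Connected = ∀ x y → Star Comparable x y

  IsChain : Set
  IsChain = ∀ x y → Comparable x y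

  IsColorMax : Fin n → Set
  IsColorMax x = ∀ y → κ y ≡ κ x → y ≼ x

  IsColorMin : Fin n → Set
  IsColorMin x = ∀ y → κ y ≡ κ x → x ≼ y

  Consecutive : Fin k → Fin n → Fin n → Set
  Consecutive a x y = κ x ≡ a × κ y ≡ a × x ≺ y
                      × (∀ z → x ≺ z → z ≺ y → κ z ≢ a)

  private
    _≺?_ : ∀ x y → Dec (x ≺ y)
    x ≺? y with x ≼? y | x ≟ y
    ... | yes p | no q = yes (p , q)
    ... | yes p | yes q = no (λ { (_ , r) → r q })
    ... | no p | _ = no (λ { (r , _) → p r })

    adj? : ∀ a b → Dec (Adjacent Γ a b)
    adj? a b with a ≟ b | θ a b ℤ.<? 0ℤ
    ... | yes e | _ = no (λ { (ne , _) → ne e })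
    ... | no ne | yes l = yes (ne , l)
    ... | no ne | no nl = no (λ { (_ , l) → nl l })

    interval? : ∀ x y → Decidable (λ z → x ≺ z × z ≺ y)
    interval? x y z with x ≺? z | z ≺? y
    ... | yes p | yes q = yes (p , q)
    ... | no p | _ = no (λ { (r , _) → p r })
    ... | yes _ | no q = no (λ { (_ , r) → q r })

    upper? : ∀ x → Decidable (λ y → x ≺ y × Adjacent Γ (κ y) (κ x))
    upper? x y with x ≺? y | adj? (κ y) (κ x)
    ... | yes p | yes q = yes (p , q)
    ... | no p | _ = no (λ { (r , _) → p r })
    ... | yes _ | no q = no (λ { (_ , r) → q r })

    lower? : ∀ x → Decidable (λ y → y ≺ x × Adjacent Γ (κ y) (κ x))
    lower? x y with y ≺? x | adj? (κ y) (κ x)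
    ... | yes p | yes q = yes (p , q)
    ... | no p | _ = no (λ { (r , _) → p r })
    ... | yes _ | no q = no (λ { (_ , r) → q r })

  intervalWeight : Fin k → Fin n → Fin n → ℤ
  intervalWeight a x y = ∑[ interval? x y ∣ (λ z → - θ (κ z) a) ]

  upperWeight : Fin n → ℤ
  upperWeight x = ∑[ upper? x ∣ (λ y → - θ (κ y) (κ x)) ]

  lowerWeight : Fin n → ℤ
  lowerWeight x = ∑[ lower? x ∣ (λ y → - θ (κ y) (κ x)) ]

  -- axioms (local finiteness and finiteness of U, L are automatic)
  EC : Set
  EC = ∀ x y → κ x ≡ κ y → Comparable x y

  NA : Set
  NA = ∀ x y → x ⋖ y → Adjacent Γ (κ x) (κ y)

  AC : Set
  AC = ∀ x y → Adjacent Γ (κ x) (κ y) → Comparable x y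

  ICE2 : Set
  ICE2 = ∀ a x y → Consecutive a x y → intervalWeight a x y ≡ + 2

  UCB1 : Set
  UCB1 = ∀ x → IsColorMax x → upperWeight x ℤ.≤ 1ℤ

  LCB1 : Set
  LCB1 = ∀ x → IsColorMin x → lowerWeight x ℤ.≤ 1ℤ

  IsDComplete : Set
  IsDComplete = EC × NA × AC × ICE2 × UCB1

  IsMinuscule : Set
  IsMinuscule = IsDComplete × LCB1

  -- top tree T = elements maximal among their color
  SlantIrreducible : Set
  SlantIrreducible =
    Connected ×
    (∀ x y → IsColorMax x → IsColorMax y → x ⋖ y →
       ∃[ z ] (z ≢ y × κ z ≡ κ y))

-- If P is not slant irreducible, some cover x ⋖ y of the top tree has y alone in
-- its colour.  By (UCB1) and (LCB1) a colour-maximal element has at most one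
-- upper neighbour of adjacent colour and a colour-minimal element at most one
-- lower one.  Hence x is alone as well, aloneness propagates upwards from y and
-- (dually) downwards from x, and the set of elements above y or below x is closed
-- under comparability; by connectedness every element is alone in its colour.
-- Then the covers of a common lower (or upper) bound of two elements coincide,
-- which makes comparability transitive, so P is a chain; and each edge a ∼ b
-- contributes -θ_ab ≥ 1 to a weight at most 1, so θ_ab = -1.
module Submission where

open import Defs
open import Data.Nat using (suc; s≤s; z≤n)
open import Data.Fin using (Fin; _≟_)
open import Data.Fin.Induction using (po-wellFounded; po-noetherian)
open import Data.Fin.Properties using (any?; all?)
open import Data.Integer using (ℤ; +_; -_; -1ℤ; 0ℤ; 1ℤ; -[1+_]; _+_; _≤_; _<_; _<?_; nonNegative; +≤+; -<+; +<+)
import Data.Integer.Properties as ℤ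
open import Data.List using (List; []; _∷_; map; filter; foldr)
open import Data.List.Membership.Propositional using (_∈_)
open import Data.List.Membership.Propositional.Properties using (∈-allFin)
open import Data.List.Relation.Unary.Any using (here; there)
open import Data.Product using (∃-syntax; _×_; _,_; proj₁; proj₂; map₁; map₂)
open import Data.Sum using (_⊎_; inj₁; inj₂; swap)
open import Data.Empty using (⊥-elim)
open import Function using (flip; id; _∘_)
open import Induction.WellFounded using (WellFounded; Acc; acc)
open import Level using (0ℓ)
open import Relation.Binary using (Symmetric)
open import Relation.Binary.Structures using (IsDecPartialOrder)
import Relation.Binary.Construct.Flip.EqAndOrd as Flip
import Relation.Binary.Construct.NonStrictToStrict as Strict
open import Relation.Binary.Construct.Closure.ReflexiveTransitive using (fold)
open import Relation.Binary.PropositionalEquality using (_≡_; _≢_; refl; sym; subst; ≢-sym)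
open import Relation.Nullary using (¬_; Dec; yes; no)
open import Relation.Nullary.Decidable using (_×-dec_; _→-dec_; ¬?)
open import Relation.Unary using (Pred; Decidable)

AtMostOne : {A : Set} → Pred A 0ℓ → Set
AtMostOne Q = ∀ {z z'} → Q z → Q z' → z ≡ z'

module _ {A : Set} {Q : Pred A 0ℓ} (Q? : Decidable Q) (f : A → ℤ)
         (f≥0 : ∀ {z} → Q z → 0ℤ ≤ f z) where

  sumOver : List A → ℤ
  sumOver l = foldr _+_ 0ℤ (map f (filter Q? l))

  sumOver-nonneg : ∀ l → 0ℤ ≤ sumOver l
  sumOver-nonneg []       = ℤ.≤-refl
  sumOver-nonneg (z ∷ zs) with Q? z
  ... | yes q = ℤ.+-mono-≤ (f≥0 q) (sumOver-nonneg zs)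
  ... | no _  = sumOver-nonneg zs

  term≤sumOver : ∀ {u l} → u ∈ l → Q u → f u ≤ sumOver l
  term≤sumOver {u} {z ∷ zs} (here refl) q with Q? z
  ... | yes _ = ℤ.i≤i+j (f u) (sumOver zs) {{nonNegative (sumOver-nonneg zs)}}
  ... | no ¬q = ⊥-elim (¬q q)
  term≤sumOver {l = z ∷ zs} (there u∈zs) q with Q? z
  ... | yes qz = ℤ.i≤j⇒i≤k+j (f z) {{nonNegative (f≥0 qz)}} (term≤sumOver u∈zs q)
  ... | no _   = term≤sumOver u∈zs q

  two-terms≤sumOver : ∀ {u v l} → u ∈ l → v ∈ l → Q u → Q v → u ≢ v →
                      f u + f v ≤ sumOver l
  two-terms≤sumOver (here refl) (here refl) _ _ u≢v = ⊥-elim (u≢v refl)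
  two-terms≤sumOver {u} {l = z ∷ zs} (here refl) (there v∈zs) qu qv _ with Q? z
  ... | yes _ = ℤ.+-monoʳ-≤ (f u) (term≤sumOver v∈zs qv)
  ... | no ¬q = ⊥-elim (¬q qu)
  two-terms≤sumOver {u} {v} (there u∈zs) (here refl) qu qv v≢u =
    subst (_≤ _) (ℤ.+-comm (f v) (f u))
      (two-terms≤sumOver (here refl) (there u∈zs) qv qu (≢-sym v≢u))
  two-terms≤sumOver {l = z ∷ zs} (there u∈zs) (there v∈zs) qu qv u≢v with Q? z
  ... | yes qz = ℤ.i≤j⇒i≤k+j (f z) {{nonNegative (f≥0 qz)}} (two-terms≤sumOver u∈zs v∈zs qu qv u≢v)
  ... | no _   = two-terms≤sumOver u∈zs v∈zs qu qv u≢v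

i<0⇒1≤-i : ∀ {i} → i < 0ℤ → 1ℤ ≤ - i
i<0⇒1≤-i { -[1+ _ ]} -<+ = +≤+ (s≤s z≤n)

i<0∧-i≤1⇒i≡-1 : ∀ {i} → i < 0ℤ → - i ≤ 1ℤ → i ≡ -1ℤ
i<0∧-i≤1⇒i≡-1 { -[1+ 0 ]}     _ _                = refl
i<0∧-i≤1⇒i≡-1 { -[1+ suc _ ]} _ (+≤+ (s≤s ()))
i<0∧-i≤1⇒i≡-1 { + _ }        (+<+ ()) _

module _ (Γ : Dynkin) where
  open Dynkin Γ

  adjacent-sym : Symmetric (Adjacent Γ)
  adjacent-sym {a} {b} (a≢b , θab<0) =
    ≢-sym a≢b , ℤ.≤∧≢⇒< (θ-offdiag b a (≢-sym a≢b)) θba≢0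
    where
    θba≢0 : θ b a ≢ 0ℤ
    θba≢0 θba≡0 = ℤ.<⇒≢ θab<0 (proj₂ (θ-zero a b) θba≡0)

  adjacent⇒-1⇒simplyLaced : (∀ {a b} → Adjacent Γ a b → θ a b ≡ -1ℤ) → SimplyLaced Γ
  adjacent⇒-1⇒simplyLaced edge a b with a ≟ b
  ... | yes refl = inj₂ (inj₂ (θ-diag a))
  ... | no a≢b with θ a b <? 0ℤ
  ...   | yes θab<0 = inj₁ (edge (a≢b , θab<0))
  ...   | no θab≮0  = inj₂ (inj₁ (ℤ.≤∧≮⇒≡ (θ-offdiag a b a≢b) θab≮0))

  module _ {n} {Q : Pred (Fin n) 0ℓ} {Q? : Decidable Q} {c : Fin n → Fin k} {a : Fin k}
           (Q⇒adjacent : ∀ {z} → Q z → Adjacent Γ (c z) a)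
           (weight≤1 : ∑[ Q? ∣ (λ z → - θ (c z) a) ] ≤ 1ℤ) where

    private
      weight : Fin n → ℤ
      weight z = - θ (c z) a

      weight≥1 : ∀ {z} → Q z → 1ℤ ≤ weight z
      weight≥1 = i<0⇒1≤-i ∘ proj₂ ∘ Q⇒adjacent

      weight≥0 : ∀ {z} → Q z → 0ℤ ≤ weight z
      weight≥0 = ℤ.≤-trans (+≤+ z≤n) ∘ weight≥1

    weight≤1⇒atMostOne : AtMostOne Q
    weight≤1⇒atMostOne {z} {z'} qz qz' with z ≟ z'
    ... | yes z≡z' = z≡z'
    ... | no z≢z' with ℤ.≤-trans (ℤ.+-mono-≤ (weight≥1 qz) (weight≥1 qz'))
                         (ℤ.≤-trans (two-terms≤sumOver Q? weight weight≥0
                                       (∈-allFin z) (∈-allFin z') qz qz' z≢z')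
                                    weight≤1)
    ...   | +≤+ (s≤s ())

    weight≤1⇒θ≡-1 : ∀ {z} → Q z → θ (c z) a ≡ -1ℤ
    weight≤1⇒θ≡-1 {z} qz =
      i<0∧-i≤1⇒i≡-1 (proj₂ (Q⇒adjacent qz))
        (ℤ.≤-trans (term≤sumOver Q? weight weight≥0 (∈-allFin z) qz) weight≤1)

_ᵒᵖ : ∀ {Γ} → ColoredPoset Γ → ColoredPoset Γ
P ᵒᵖ = record
  { n       = n
  ; _≼_     = flip _≼_
  ; isDecPO = record
    { isPartialOrder = Flip.isPartialOrder isPartialOrder
    ; _≟_            = _≟_
    ; _≤?_           = flip _≼?_
    }
  ; κ       = κ
  ; κ-surj  = κ-surj
  }
  where
  open ColoredPoset P
  open IsDecPartialOrder isDecPO using (isPartialOrder)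

module Order {Γ : Dynkin} (P : ColoredPoset Γ) where
  open ColoredPoset P
  open IsDecPartialOrder isDecPO using (isPartialOrder)
    renaming (refl to ≼-refl; trans to ≼-trans)
  private module Op = ColoredPoset (P ᵒᵖ)

  U L : Fin n → Pred (Fin n) 0ℓ
  U x y = x ≺ y × Adjacent Γ (κ y) (κ x)
  L x y = y ≺ x × Adjacent Γ (κ y) (κ x)

  Alone : Pred (Fin n) 0ℓ
  Alone x = ∀ y → κ y ≡ κ x → y ≡ x

  alone⇒colorMax : ∀ {x} → Alone x → IsColorMax x
  alone⇒colorMax alone y κy≡κx = subst (_≼ _) (sym (alone y κy≡κx)) ≼-refl

  alone⇒colorMin : ∀ {x} → Alone x → IsColorMin x
  alone⇒colorMin alone y κy≡κx = subst (_ ≼_) (sym (alone y κy≡κx)) ≼-refl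

  alone? : Decidable Alone
  alone? x = all? (λ y → (κ y ≟ κ x) →-dec (y ≟ x))

  colorMax? : Decidable IsColorMax
  colorMax? x = all? (λ y → (κ y ≟ κ x) →-dec (y ≼? x))

  _≺?_ : ∀ x y → Dec (x ≺ y)
  _≺?_ = Strict.<-decidable _≡_ _≼_ _≟_ _≼?_

  _⋖?_ : ∀ x y → Dec (x ⋖ y)
  x ⋖? y = (x ≺? y) ×-dec all? (λ z → ¬? ((x ≺? z) ×-dec (z ≺? y)))

  BadCover : Fin n → Fin n → Set
  BadCover x y = IsColorMax x × x ⋖ y × Alone y

  badCover? : ∀ x y → Dec (BadCover x y)
  badCover? x y = colorMax? x ×-dec (x ⋖? y) ×-dec alone? y

  ≺-trans : ∀ {x y z} → x ≺ y → y ≺ z → x ≺ z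
  ≺-trans = Strict.<-trans _≡_ _≼_ isPartialOrder

  ≼-split : ∀ {x y} → x ≼ y → x ≡ y ⊎ x ≺ y
  ≼-split {x} {y} x≼y with x ≟ y
  ... | yes x≡y = inj₁ x≡y
  ... | no x≢y  = inj₂ (x≼y , x≢y)

  ≺-wellFounded : WellFounded _≺_
  ≺-wellFounded = po-wellFounded isPartialOrder

  ≺-noetherian : WellFounded (flip _≺_)
  ≺-noetherian = po-noetherian isPartialOrder

  cover-below : ∀ {x y} → x ≺ y → ∃[ d ] (x ≼ d × d ⋖ y)
  cover-below {x} {y} = go (≺-noetherian x)
    where
    go : ∀ {x} → Acc (flip _≺_) x → x ≺ y → ∃[ d ] (x ≼ d × d ⋖ y)
    go {x} (acc larger) x≺y with any? (λ z → (x ≺? z) ×-dec (z ≺? y))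
    ... | no ∄z               = x , ≼-refl , x≺y , λ z x≺z≺y → ∄z (z , x≺z≺y)
    ... | yes (z , x≺z , z≺y) = map₂ (map₁ (≼-trans (proj₁ x≺z))) (go (larger x≺z) z≺y)

  cover-above : ∀ {x y} → x ≺ y → ∃[ c ] (x ⋖ c × c ≼ y)
  cover-above {x} {y} = go (≺-wellFounded y)
    where
    go : ∀ {y} → Acc _≺_ y → x ≺ y → ∃[ c ] (x ⋖ c × c ≼ y)
    go {y} (acc smaller) x≺y with any? (λ z → (x ≺? z) ×-dec (z ≺? y))
    ... | no ∄z               = y , (x≺y , λ z x≺z≺y → ∄z (z , x≺z≺y)) , ≼-refl
    ... | yes (z , x≺z , z≺y) =
      map₂ (map₂ (λ c≼z → ≼-trans c≼z (proj₁ z≺y))) (go (smaller z≺y) x≺z)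

  ≺ᵒᵖ⇒≻ : ∀ {x y} → Op._≺_ x y → y ≺ x
  ≺ᵒᵖ⇒≻ = map₂ ≢-sym

  ≻⇒≺ᵒᵖ : ∀ {x y} → y ≺ x → Op._≺_ x y
  ≻⇒≺ᵒᵖ = map₂ ≢-sym

  ⋖ᵒᵖ⇒⋗ : ∀ {x y} → Op._⋖_ x y → y ⋖ x
  ⋖ᵒᵖ⇒⋗ (x≺ᵒy , nothing-between) =
    ≺ᵒᵖ⇒≻ x≺ᵒy , λ z (y≺z , z≺x) → nothing-between z (≻⇒≺ᵒᵖ z≺x , ≻⇒≺ᵒᵖ y≺z)

  ⋗⇒⋖ᵒᵖ : ∀ {x y} → y ⋖ x → Op._⋖_ x y
  ⋗⇒⋖ᵒᵖ (y≺x , nothing-between) =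
    ≻⇒≺ᵒᵖ y≺x , λ z (x≺ᵒz , z≺ᵒy) → nothing-between z (≺ᵒᵖ⇒≻ z≺ᵒy , ≺ᵒᵖ⇒≻ x≺ᵒz)

record NeighbourAxioms {Γ : Dynkin} (P : ColoredPoset Γ) : Set where
  open ColoredPoset P
  open Order P using (U; L)
  field
    neighbours-adjacent : NA
    adjacent-comparable : AC
    U-atMostOne         : ∀ {x} → IsColorMax x → AtMostOne (U x)
    L-atMostOne         : ∀ {x} → IsColorMin x → AtMostOne (L x)

module _ {Γ : Dynkin} {P : ColoredPoset Γ} where
  open ColoredPoset P
  open Dynkin Γ using (θ)
  open Order P

  UCB1⇒U-atMostOne : UCB1 → ∀ {x} → IsColorMax x → AtMostOne (U x)
  UCB1⇒U-atMostOne ucb1 {x} max-x = weight≤1⇒atMostOne Γ proj₂ (ucb1 x max-x)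

  LCB1⇒L-atMostOne : LCB1 → ∀ {x} → IsColorMin x → AtMostOne (L x)
  LCB1⇒L-atMostOne lcb1 {x} min-x = weight≤1⇒atMostOne Γ proj₂ (lcb1 x min-x)

  UCB1⇒U-θ≡-1 : UCB1 → ∀ {x y} → IsColorMax x → U x y → θ (κ y) (κ x) ≡ -1ℤ
  UCB1⇒U-θ≡-1 ucb1 {x} max-x = weight≤1⇒θ≡-1 Γ {c = κ} proj₂ (ucb1 x max-x)

  LCB1⇒L-θ≡-1 : LCB1 → ∀ {x y} → IsColorMin x → L x y → θ (κ y) (κ x) ≡ -1ℤ
  LCB1⇒L-θ≡-1 lcb1 {x} min-x = weight≤1⇒θ≡-1 Γ {c = κ} proj₂ (lcb1 x min-x)

  minuscule⇒neighbourAxioms : IsMinuscule → NeighbourAxioms P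
  minuscule⇒neighbourAxioms ((_ , na , ac , _ , ucb1) , lcb1) = record
    { neighbours-adjacent = na
    ; adjacent-comparable = ac
    ; U-atMostOne         = UCB1⇒U-atMostOne ucb1
    ; L-atMostOne         = LCB1⇒L-atMostOne lcb1
    }

  neighbourAxioms-ᵒᵖ : NeighbourAxioms P → NeighbourAxioms (P ᵒᵖ)
  neighbourAxioms-ᵒᵖ ax = record
    { neighbours-adjacent = λ x y x⋖ᵒy →
        adjacent-sym Γ (neighbours-adjacent y x (⋖ᵒᵖ⇒⋗ x⋖ᵒy))
    ; adjacent-comparable = λ x y κx∼κy → swap (adjacent-comparable x y κx∼κy)
    ; U-atMostOne         = λ min z z' → L-atMostOne min (map₁ ≺ᵒᵖ⇒≻ z) (map₁ ≺ᵒᵖ⇒≻ z')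
    ; L-atMostOne         = λ max z z' → U-atMostOne max (map₁ ≺ᵒᵖ⇒≻ z) (map₁ ≺ᵒᵖ⇒≻ z')
    }
    where open NeighbourAxioms ax

module Spreading {Γ : Dynkin} {P : ColoredPoset Γ} (ax : NeighbourAxioms P) where
  open ColoredPoset P
  open IsDecPartialOrder isDecPO using () renaming (refl to ≼-refl; trans to ≼-trans)
  open Order P
  open NeighbourAxioms ax

  ⋖⇒U : ∀ {x y} → x ⋖ y → U x y
  ⋖⇒U {x} {y} x⋖y = proj₁ x⋖y , adjacent-sym Γ (neighbours-adjacent x y x⋖y)

  ⋖⇒L : ∀ {x y} → x ⋖ y → L y x
  ⋖⇒L {x} {y} x⋖y = proj₁ x⋖y , neighbours-adjacent x y x⋖y

  alone-cover⇒alone : ∀ {x y} → IsColorMax x → x ⋖ y → Alone y → Alone x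
  alone-cover⇒alone {x} {y} max-x x⋖y alone-y z κz≡κx with ≼-split (max-x z κz≡κx)
  ... | inj₁ z≡x = z≡x
  ... | inj₂ z≺x = L-atMostOne (alone⇒colorMin alone-y) z∈L (⋖⇒L x⋖y)
    where
    z∈L : L y z
    z∈L = ≺-trans z≺x (proj₁ x⋖y)
        , subst (λ a → Adjacent Γ a (κ y)) (sym κz≡κx) (neighbours-adjacent x y x⋖y)

  comparable-above : (∀ t → Alone t) → ∀ {p a b} → p ≼ a → p ≼ b → Comparable a b
  comparable-above all-alone {p} = go (≺-noetherian p)
    where
    -- p is colour-maximal, so its covers towards a and towards b coincide.
    go : ∀ {p a b} → Acc (flip _≺_) p → p ≼ a → p ≼ b → Comparable a b
    go (acc larger) p≼a p≼b with ≼-split p≼a | ≼-split p≼b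
    ... | inj₁ refl | _         = inj₁ p≼b
    ... | inj₂ _    | inj₁ refl = inj₂ p≼a
    ... | inj₂ p≺a  | inj₂ p≺b  with cover-above p≺a | cover-above p≺b
    ...   | c , p⋖c , c≼a | c' , p⋖c' , c'≼b
          with U-atMostOne (alone⇒colorMax (all-alone _)) (⋖⇒U p⋖c) (⋖⇒U p⋖c')
    ...     | refl = go (larger (proj₁ p⋖c)) c≼a c'≼b

  -- Aloneness by itself does not pass to an upper neighbour w of u: a second
  -- element of colour κ w could lie below u, and is excluded only if L(u) is alone.
  Settled : Pred (Fin n) 0ℓ
  Settled t = Alone t × (∀ {z} → L t z → Alone z)

  settled-upward : ∀ {u w} → Settled u → U u w → Settled w
  settled-upward {u} {w} (alone-u , alone-below-u) (u≺w , κw∼κu) = alone-w , alone-below-w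
    where
    alone-w : Alone w
    alone-w w' κw'≡κw = w'≡w (adjacent-comparable u w' (adjacent-sym Γ κw'∼κu))
      where
      κw'∼κu : Adjacent Γ (κ w') (κ u)
      κw'∼κu = subst (λ a → Adjacent Γ a (κ u)) (sym κw'≡κw) κw∼κu

      w'≡w : Comparable u w' → w' ≡ w
      w'≡w (inj₁ u≼w') with ≼-split u≼w'
      ... | inj₁ refl = sym (alone-u w (sym κw'≡κw))
      ... | inj₂ u≺w' = U-atMostOne (alone⇒colorMax alone-u) (u≺w' , κw'∼κu) (u≺w , κw∼κu)
      w'≡w (inj₂ w'≼u) with ≼-split w'≼u
      ... | inj₁ refl = sym (alone-u w (sym κw'≡κw))
      ... | inj₂ w'≺u = sym (alone-below-u (w'≺u , κw'∼κu) w (sym κw'≡κw))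

    alone-below-w : ∀ {z} → L w z → Alone z
    alone-below-w z∈L = subst Alone (sym (L-atMostOne (alone⇒colorMin alone-w) z∈L u∈L)) alone-u
      where
      u∈L : L w u
      u∈L = u≺w , adjacent-sym Γ κw∼κu

  module FromAloneCover {x y} (x⋖y : x ⋖ y) (alone-x : Alone x) (alone-y : Alone y) where

    settled-above : ∀ {t} → y ≼ t → Settled t
    settled-above {t} = go (≺-wellFounded t)
      where
      settled-y : Settled y
      settled-y = alone-y , λ z∈L →
        subst Alone (sym (L-atMostOne (alone⇒colorMin alone-y) z∈L (⋖⇒L x⋖y))) alone-x

      go : ∀ {t} → Acc _≺_ t → y ≼ t → Settled t
      go (acc smaller) y≼t with ≼-split y≼t
      ... | inj₁ refl = settled-y
      ... | inj₂ y≺t with cover-below y≺t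
      ...   | s , y≼s , s⋖t = settled-upward (go (smaller (proj₁ s⋖t)) y≼s) (⋖⇒U s⋖t)

    AboveOrBelow : Pred (Fin n) 0ℓ
    AboveOrBelow t = y ≼ t ⊎ t ≼ x

    lower-neighbour-aboveOrBelow : ∀ {c} → y ≼ c → ∃[ s ] (L c s × AboveOrBelow s)
    lower-neighbour-aboveOrBelow y≼c with ≼-split y≼c
    ... | inj₁ refl = x , ⋖⇒L x⋖y , inj₂ ≼-refl
    ... | inj₂ y≺c with cover-below y≺c
    ...   | s , y≼s , s⋖c = s , ⋖⇒L s⋖c , inj₁ y≼s

    aboveOrBelow-downward : ∀ {p q} → q ≼ p → AboveOrBelow p → AboveOrBelow q
    aboveOrBelow-downward q≼p (inj₂ p≼x) = inj₂ (≼-trans q≼p p≼x)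
    aboveOrBelow-downward {p} {q} q≼p (inj₁ y≼p) = go (≺-noetherian q) q≼p
      where
      -- Climb from q along covers; once a cover c of q lies above y, q is the only
      -- element of L(c), namely the one given by lower-neighbour-aboveOrBelow.
      go : ∀ {q} → Acc (flip _≺_) q → q ≼ p → AboveOrBelow q
      go (acc larger) q≼p with ≼-split q≼p
      ... | inj₁ refl = inj₁ y≼p
      ... | inj₂ q≺p with cover-above q≺p
      ...   | c , q⋖c , c≼p with go (larger (proj₁ q⋖c)) c≼p
      ...     | inj₂ c≼x = inj₂ (≼-trans (proj₁ (proj₁ q⋖c)) c≼x)
      ...     | inj₁ y≼c with lower-neighbour-aboveOrBelow y≼c
      ...       | s , s∈L , s-aboveOrBelow =
        subst AboveOrBelow
          (L-atMostOne (alone⇒colorMin (proj₁ (settled-above y≼c))) s∈L (⋖⇒L q⋖c))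
          s-aboveOrBelow

module _ {Γ : Dynkin} {P : ColoredPoset Γ} (ax : NeighbourAxioms P) where
  open ColoredPoset P
  open IsDecPartialOrder isDecPO using () renaming (refl to ≼-refl; trans to ≼-trans)
  open Order P
  private
    module Up   = Spreading ax
    module Down = Spreading (neighbourAxioms-ᵒᵖ ax)

  module _ (connected : Connected) {x y} (bad : BadCover x y) where
    private
      x⋖y : x ⋖ y
      x⋖y = proj₁ (proj₂ bad)

      alone-y : Alone y
      alone-y = proj₂ (proj₂ bad)

      alone-x : Alone x
      alone-x = Up.alone-cover⇒alone (proj₁ bad) x⋖y alone-y

      module Above = Up.FromAloneCover x⋖y alone-x alone-y
      module Below = Down.FromAloneCover (⋗⇒⋖ᵒᵖ x⋖y) alone-y alone-x

      aboveOrBelow-comparable : ∀ {p q} → Comparable p q →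
                                Above.AboveOrBelow p → Above.AboveOrBelow q
      aboveOrBelow-comparable (inj₂ q≼p) = Above.aboveOrBelow-downward q≼p
      aboveOrBelow-comparable (inj₁ p≼q) = swap ∘ Below.aboveOrBelow-downward p≼q ∘ swap

      aboveOrBelow-everywhere : ∀ t → Above.AboveOrBelow t
      aboveOrBelow-everywhere t =
        fold (λ p q → Above.AboveOrBelow p → Above.AboveOrBelow q)
             (λ p~q q→r → q→r ∘ aboveOrBelow-comparable p~q) id
             (connected y t) (inj₁ ≼-refl)

    badCover⇒all-alone : ∀ t → Alone t
    badCover⇒all-alone t with aboveOrBelow-everywhere t
    ... | inj₁ y≼t = proj₁ (Above.settled-above y≼t)
    ... | inj₂ t≼x = proj₁ (Below.settled-above t≼x)

    private
      comparable-trans : ∀ {p r s} → Comparable p r → Comparable r s → Comparable p s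
      comparable-trans (inj₁ p≼r) (inj₁ r≼s) = inj₁ (≼-trans p≼r r≼s)
      comparable-trans (inj₂ r≼p) (inj₁ r≼s) = Up.comparable-above badCover⇒all-alone r≼p r≼s
      comparable-trans (inj₁ p≼r) (inj₂ s≼r) = swap (Down.comparable-above badCover⇒all-alone p≼r s≼r)
      comparable-trans (inj₂ r≼p) (inj₂ s≼r) = inj₂ (≼-trans s≼r r≼p)

    badCover⇒isChain : IsChain
    badCover⇒isChain p q = fold Comparable comparable-trans (inj₁ ≼-refl) (connected p q)

module _ {Γ : Dynkin} (P : ColoredPoset Γ) where
  open Dynkin Γ
  open ColoredPoset P
  open Order P

  all-alone⇒simplyLaced : AC → UCB1 → LCB1 → (∀ t → Alone t) → SimplyLaced Γ
  all-alone⇒simplyLaced ac ucb1 lcb1 all-alone = adjacent⇒-1⇒simplyLaced Γ edge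
    where
    edge : ∀ {a b} → Adjacent Γ a b → θ a b ≡ -1ℤ
    edge {a} {b} a∼b with κ-surj a | κ-surj b
    ... | u , refl | v , refl with ac u v a∼b
    ...   | inj₁ u≼v = LCB1⇒L-θ≡-1 lcb1 (alone⇒colorMin (all-alone v))
                         ((u≼v , λ { refl → proj₁ a∼b refl }) , a∼b)
    ...   | inj₂ v≼u = UCB1⇒U-θ≡-1 ucb1 (alone⇒colorMax (all-alone v))
                         ((v≼u , λ { refl → proj₁ a∼b refl }) , a∼b)

  no-badCover⇒slantIrreducible : Connected → (∀ x y → ¬ BadCover x y) → SlantIrreducible
  no-badCover⇒slantIrreducible connected no-bad = connected , other-of-colour
    where
    other-of-colour : ∀ x y → IsColorMax x → IsColorMax y → x ⋖ y →
                      ∃[ z ] (z ≢ y × κ z ≡ κ y)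
    other-of-colour x y max-x _ x⋖y with any? (λ z → ¬? (z ≟ y) ×-dec (κ z ≟ κ y))
    ... | yes other = other
    ... | no ∄other = ⊥-elim (no-bad x y (max-x , x⋖y , alone-y))
      where
      alone-y : Alone y
      alone-y z κz≡κy with z ≟ y
      ... | yes z≡y = z≡y
      ... | no z≢y  = ⊥-elim (∄other (z , z≢y , κz≡κy))

proposition3p4 : (Γ : Dynkin) (P : ColoredPoset Γ) →
    ColoredPoset.Connected P → ColoredPoset.IsMinuscule P →
    (ColoredPoset.IsChain P × SimplyLaced Γ) ⊎ ColoredPoset.SlantIrreducible P
proposition3p4 Γ P connected minuscule@((_ , _ , ac , _ , ucb1) , lcb1)
  with any? (λ x → any? (Order.badCover? P x))
... | yes (_ , _ , bad) =
  inj₁ ( badCover⇒isChain ax connected bad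
       , all-alone⇒simplyLaced P ac ucb1 lcb1 (badCover⇒all-alone ax connected bad))
  where ax = minuscule⇒neighbourAxioms minuscule
... | no ∄bad = inj₂ (no-badCover⇒slantIrreducible P connected (λ x y bad → ∄bad (x , y , bad)))
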